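{- Let $P$ be a PLSC of order $n$ in which automatic elimination has been performed. Let $A_1$ and $A_2$ be any two runs of the primary extension procedure on $P$ (with arbitrary choices of desolate dots), with final configurations $R_1$ and $R_2$. If $R_1$ contains an eliminated file, then $R_2$ also contains an eliminated file. If $R_1$ is completed (every line contains a rook), then $R_2$ is also completed and $R_1=R_2$. Otherwise $R_1=R_2$, i.e. they have exactly the same rooks and the same dots.
   Context: A PLSC (partial Latin super cube) of order $n$ is an assignment to each cell of $\{1,\ldots,n\}^3$ of one of three states: rook, dot, or empty, such that no two rooks lie on a common line (a line, or file, is a set of $n$ cells obtained by fixing two coordinates). Automatic elimination means making empty every dot that lies on a line containing a rook. An eliminated file is a line containing neither a rook nor a dot. A dot is desolate if some line contains it as its only dot (and no rook). The primary extension procedure: start with $P_0=P$; repeatedly: if every line contains a rook, stop; if there is an eliminated file, stop; if there is no desolate dot, stop; otherwise select an arbitrary desolate dot, replace it by a rook, perform automatic elimination, and repeat. -}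

module Defs where

open import Data.Nat using (ℕ)
open import Data.Fin using (Fin)
open import Data.Fin.Properties using (any?) renaming (_≟_ to _≟ᶠ_)
open import Data.Product using (Σ; ∃; ∃-syntax; _×_; _,_)
open import Data.Product.Properties using (≡-dec)
open import Data.Sum using (_⊎_)
open import Data.Bool using (Bool; true; false; if_then_else_; _∧_)
open import Relation.Nullary using (¬_; Dec; yes; no)
open import Relation.Nullary.Decidable using (⌊_⌋)
open import Relation.Binary.PropositionalEquality using (_≡_; _≢_; refl)
open import Relation.Binary.Construct.Closure.ReflexiveTransitive using (Star)

data State : Set where
  rook dot empty : State

isRook : State → Bool
isRook rook = true
isRook _    = false

isDot : State → Bool
isDot dot = true
isDot _   = false

Cell : ℕ → Set
Cell n = Fin n × Fin n × Fin n

_≟ᶜ_ : ∀ {n} (x y : Cell n) → Dec (x ≡ y)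
_≟ᶜ_ = ≡-dec _≟ᶠ_ (≡-dec _≟ᶠ_ _≟ᶠ_)

-- The three directions of lines (which coordinate varies)
data Dir : Set where
  d₁ d₂ d₃ : Dir

-- set d k c : the cell obtained from c by replacing coordinate d by k.
-- The line through c in direction d is { set d k c | k : Fin n }.
set : ∀ {n} → Dir → Fin n → Cell n → Cell n
set d₁ k (x , y , z) = (k , y , z)
set d₂ k (x , y , z) = (x , k , z)
set d₃ k (x , y , z) = (x , y , k)

Config : ℕ → Set
Config n = Cell n → State

IsPLSC : ∀ {n} → Config n → Set
IsPLSC {n} P = ∀ (d : Dir) (c : Cell n) (k k' : Fin n) →
  P (set d k c) ≡ rook → P (set d k' c) ≡ rook → k ≡ k'

LineHasRook : ∀ {n} → Config n → Dir → Cell n → Set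
LineHasRook {n} P d c = ∃[ k ] P (set d k c) ≡ rook

lineHasRook : ∀ {n} → Config n → Dir → Cell n → Bool
lineHasRook P d c = ⌊ any? (λ k → isRook (P (set d k c)) ≟b true) ⌋
  where
  open import Data.Bool.Properties using () renaming (_≟_ to _≟b_)

someLineHasRook : ∀ {n} → Config n → Cell n → Bool
someLineHasRook P c = lineHasRook P d₁ c Data.Bool.∨ (lineHasRook P d₂ c Data.Bool.∨ lineHasRook P d₃ c)
  where import Data.Bool

autoElim : ∀ {n} → Config n → Config n
autoElim P c = if isDot (P c) ∧ someLineHasRook P c then empty else P c

-- P is closed under automatic elimination (elimination has been performed)
AutoEliminated : ∀ {n} → Config n → Set
AutoEliminated {n} P = ∀ (c : Cell n) → P c ≡ dot → ∀ (d : Dir) → ¬ LineHasRook P d c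

Completed : ∀ {n} → Config n → Set
Completed {n} P = ∀ (d : Dir) (c : Cell n) → LineHasRook P d c

HasEliminatedFile : ∀ {n} → Config n → Set
HasEliminatedFile {n} P = Σ Dir λ d → Σ (Cell n) λ c →
  ∀ (k : Fin n) → (P (set d k c) ≢ rook) × (P (set d k c) ≢ dot)

Desolate : ∀ {n} → Config n → Cell n → Set
Desolate {n} P c = P c ≡ dot × Σ Dir λ d →
  (∀ (k : Fin n) → P (set d k c) ≢ rook) ×
  (∀ (k : Fin n) → P (set d k c) ≡ dot → set d k c ≡ c)

HasDesolate : ∀ {n} → Config n → Set
HasDesolate {n} P = Σ (Cell n) λ c → Desolate P c

placeRook : ∀ {n} → Config n → Cell n → Config n
placeRook P c x with x ≟ᶜ c
... | yes _ = rook
... | no  _ = P x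

Step : ∀ {n} → Config n → Config n → Set
Step {n} P Q = ¬ Completed P × ¬ HasEliminatedFile P ×
  Σ (Cell n) λ c → Desolate P c × (Q ≡ autoElim (placeRook P c))

Stops : ∀ {n} → Config n → Set
Stops P = Completed P ⊎ HasEliminatedFile P ⊎ ¬ HasDesolate P

Run : ∀ {n} → Config n → Config n → Set
Run P R = Star Step P R × Stops R

_≐_ : ∀ {n} → Config n → Config n → Set
_≐_ {n} P Q = ∀ (c : Cell n) → P c ≡ Q c

{-# OPTIONS --safe #-}
-- In an automatically eliminated configuration, turning the desolate dot c into a rook and
-- eliminating amounts to: put a rook at c and empty every dot sharing a line with c.  Hence two
-- different first steps c, c′ either share a line, and then each of them empties the last dot of
-- the desolate line of the other, so both runs stop at an eliminated file; or they do not, and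
-- then they commute.  A diamond argument by induction on the length of a run shows that all
-- runs end in equivalent configurations, where two configurations are equivalent if they are
-- equal or both contain an eliminated file.
module Submission where

open import Defs
open import Data.Nat using (ℕ)
open import Data.Product using (_×_; Σ; _,_; proj₁; proj₂; ∃-syntax)
open import Data.Sum using (_⊎_; inj₁; inj₂)
open import Data.Empty using (⊥-elim)
open import Data.Bool using (true; false; _∧_; _∨_; if_then_else_)
open import Data.Bool.Properties using (∨-zeroʳ)
open import Data.Fin using (Fin)
open import Data.Fin.Properties using (any?; all?)
open import Function using (_∘_)
open import Relation.Nullary using (¬_; Dec; yes; no)
open import Relation.Nullary.Decidable using (¬?; _×-dec_; map′; isYes≗does; dec-true; dec-false)
open import Relation.Binary.PropositionalEquality using (_≡_; _≢_; refl; sym; trans; cong; cong₂; subst; module ≡-Reasoning)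
open import Relation.Binary.Construct.Closure.ReflexiveTransitive using (Star; ε; _◅_)

_≟ˢ_ : (s t : State) → Dec (s ≡ t)
rook  ≟ˢ rook  = yes refl
rook  ≟ˢ dot   = no λ ()
rook  ≟ˢ empty = no λ ()
dot   ≟ˢ rook  = no λ ()
dot   ≟ˢ dot   = yes refl
dot   ≟ˢ empty = no λ ()
empty ≟ˢ rook  = no λ ()
empty ≟ˢ dot   = no λ ()
empty ≟ˢ empty = yes refl

isRook⇒≡rook : ∀ s → isRook s ≡ true → s ≡ rook
isRook⇒≡rook rook _ = refl

eliminate : State → State
eliminate dot = empty
eliminate s   = s

eliminate≢dot : ∀ s → eliminate s ≢ dot
eliminate≢dot rook  ()
eliminate≢dot dot   ()
eliminate≢dot empty ()

eliminate-rook : ∀ s → eliminate s ≡ rook → s ≡ rook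
eliminate-rook rook _ = refl

-- The new state of a cell x when a rook is placed at c, given decisions of x ≡ c (A) and of
-- x sharing a line with c (B).
update : {A B : Set} → Dec A → Dec B → State → State
update (yes _) _       s = rook
update (no _)  (yes _) s = eliminate s
update (no _)  (no _)  s = s

module _ {A B : Set} where

  update-rook : (a? : Dec A) (b? : Dec B) (s : State) → update a? b? s ≡ rook → A ⊎ s ≡ rook
  update-rook (yes a) _       s _ = inj₁ a
  update-rook (no _)  (yes _) s r = inj₂ (eliminate-rook s r)
  update-rook (no _)  (no _)  s r = inj₂ r

  update-dot : (a? : Dec A) (b? : Dec B) (s : State) → update a? b? s ≡ dot → ¬ A × ¬ B × s ≡ dot
  update-dot (yes _) _        s ()
  update-dot (no _)  (yes _)  s d = ⊥-elim (eliminate≢dot s d)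
  update-dot (no ¬a) (no ¬b)  s d = ¬a , ¬b , d

  update-yes : (a? : Dec A) (b? : Dec B) (s : State) → A → update a? b? s ≡ rook
  update-yes (yes _) _ s _ = refl
  update-yes (no ¬a) _ s a = ⊥-elim (¬a a)

  update-no-yes : (a? : Dec A) (b? : Dec B) (s : State) → ¬ A → B → update a? b? s ≡ eliminate s
  update-no-yes (yes a) _        s ¬a _ = ⊥-elim (¬a a)
  update-no-yes (no _)  (yes _)  s _  _ = refl
  update-no-yes (no _)  (no ¬b)  s _  b = ⊥-elim (¬b b)

  update-no-no : (a? : Dec A) (b? : Dec B) (s : State) → ¬ A → ¬ B → update a? b? s ≡ s
  update-no-no (yes a) _       s ¬a _  = ⊥-elim (¬a a)
  update-no-no (no _)  (yes b) s _  ¬b = ⊥-elim (¬b b)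
  update-no-no (no _)  (no _)  s _  _  = refl

update-comm : ∀ {A B A′ B′ : Set} (a? : Dec A) (b? : Dec B) (a′? : Dec A′) (b′? : Dec B′) (s : State) →
  (A → ¬ A′ × ¬ B′) → (A′ → ¬ A × ¬ B) → update a′? b′? (update a? b? s) ≡ update a? b? (update a′? b′? s)
update-comm (yes a) _       (yes a′) _        s h _  = ⊥-elim (proj₁ (h a) a′)
update-comm (yes a) _       (no _)   (yes b′) s h _  = ⊥-elim (proj₂ (h a) b′)
update-comm (yes _) _       (no _)   (no _)   s _ _  = refl
update-comm (no _)  (yes b) (yes a′) _        s _ h′ = ⊥-elim (proj₂ (h′ a′) b)
update-comm (no _)  (no _)  (yes _)  _        s _ _  = refl
update-comm (no _)  (yes _) (no _)   (yes _)  s _ _  = refl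
update-comm (no _)  (yes _) (no _)   (no _)   s _ _  = refl
update-comm (no _)  (no _)  (no _)   (yes _)  s _ _  = refl
update-comm (no _)  (no _)  (no _)   (no _)   s _ _  = refl

module _ {n : ℕ} where

  open ≡-Reasoning

  get : Dir → Cell n → Fin n
  get d₁ (x , y , z) = x
  get d₂ (x , y , z) = y
  get d₃ (x , y , z) = z

  Collinear : Cell n → Cell n → Set
  Collinear x c = Σ Dir λ d → set d (get d c) x ≡ c

  any-Dir? : {Q : Dir → Set} → (∀ d → Dec (Q d)) → Dec (Σ Dir Q)
  any-Dir? Q? with Q? d₁ | Q? d₂ | Q? d₃
  ... | yes q | _     | _     = yes (d₁ , q)
  ... | no _  | yes q | _     = yes (d₂ , q)
  ... | no _  | no _  | yes q = yes (d₃ , q)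
  ... | no ¬q₁ | no ¬q₂ | no ¬q₃ = no λ { (d₁ , q) → ¬q₁ q ; (d₂ , q) → ¬q₂ q ; (d₃ , q) → ¬q₃ q }

  any-Cell? : {Q : Cell n → Set} → (∀ c → Dec (Q c)) → Dec (Σ (Cell n) Q)
  any-Cell? Q? = map′ (λ { (x , y , z , q) → (x , y , z) , q }) (λ { ((x , y , z) , q) → x , y , z , q })
    (any? λ x → any? λ y → any? λ z → Q? (x , y , z))

  collinear? : (x c : Cell n) → Dec (Collinear x c)
  collinear? x c = any-Dir? λ d → set d (get d c) x ≟ᶜ c

  set⇒collinear : ∀ d k (x c : Cell n) → set d k x ≡ c → Collinear x c
  set⇒collinear d₁ k x _ refl = d₁ , refl
  set⇒collinear d₂ k x _ refl = d₂ , refl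
  set⇒collinear d₃ k x _ refl = d₃ , refl

  collinear-refl : ∀ (x : Cell n) → Collinear x x
  collinear-refl x = set⇒collinear d₁ (get d₁ x) x x refl

  collinear-sym : ∀ {x c : Cell n} → Collinear x c → Collinear c x
  collinear-sym {x} {c} (d , eq) = d , flip d x c eq
    where
    flip : ∀ d (x c : Cell n) → set d (get d c) x ≡ c → set d (get d x) c ≡ x
    flip d₁ _ _ refl = refl
    flip d₂ _ _ refl = refl
    flip d₃ _ _ refl = refl

  ≐-refl : ∀ {P : Config n} → P ≐ P
  ≐-refl _ = refl

  ≐-sym : ∀ {P Q : Config n} → P ≐ Q → Q ≐ P
  ≐-sym P≐Q x = sym (P≐Q x)

  ≐-trans : ∀ {P Q R : Config n} → P ≐ Q → Q ≐ R → P ≐ R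
  ≐-trans P≐Q Q≐R x = trans (P≐Q x) (Q≐R x)

  autoEliminated-resp : ∀ {P P′ : Config n} → P ≐ P′ → AutoEliminated P → AutoEliminated P′
  autoEliminated-resp eq ae x dx d (k , r) = ae x (trans (eq x) dx) d (k , trans (eq _) r)

  eliminatedFile-resp : ∀ {P P′ : Config n} → P ≐ P′ → HasEliminatedFile P → HasEliminatedFile P′
  eliminatedFile-resp eq (d , c , f) =
    d , c , λ k → (proj₁ (f k) ∘ trans (eq _)) , (proj₂ (f k) ∘ trans (eq _))

  completed-resp : ∀ {P P′ : Config n} → P ≐ P′ → Completed P → Completed P′
  completed-resp eq comp d c with comp d c
  ... | k , r = k , trans (sym (eq _)) r

  desolate-resp : ∀ {P P′ : Config n} {c} → P ≐ P′ → Desolate P c → Desolate P′ c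
  desolate-resp {c = c} eq (dc , d , noRook , onlyDot) =
    trans (sym (eq c)) dc , d , (λ k → noRook k ∘ trans (eq _)) , (λ k → onlyDot k ∘ trans (eq _))

  stops-resp : ∀ {P P′ : Config n} → P ≐ P′ → Stops P → Stops P′
  stops-resp eq (inj₁ comp)         = inj₁ (completed-resp eq comp)
  stops-resp eq (inj₂ (inj₁ ef))    = inj₂ (inj₁ (eliminatedFile-resp eq ef))
  stops-resp eq (inj₂ (inj₂ ¬des))  = inj₂ (inj₂ λ { (c , des) → ¬des (c , desolate-resp (≐-sym eq) des) })

  eliminatedFile? : (P : Config n) → Dec (HasEliminatedFile P)
  eliminatedFile? P = any-Dir? λ d → any-Cell? λ c → all? λ k →
    ¬? (P (set d k c) ≟ˢ rook) ×-dec ¬? (P (set d k c) ≟ˢ dot)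

  completed⇒¬eliminatedFile : ∀ {P : Config n} → Completed P → ¬ HasEliminatedFile P
  completed⇒¬eliminatedFile comp (d , c , f) with comp d c
  ... | k , r = proj₁ (f k) r

  desolate⇒¬completed : ∀ {P : Config n} {c} → Desolate P c → ¬ Completed P
  desolate⇒¬completed {c = c} (_ , d , noRook , _) comp with comp d c
  ... | k , r = noRook k r

  stops⇒¬step : ∀ {P Q : Config n} → Stops P → ¬ Step P Q
  stops⇒¬step (inj₁ comp)        (¬comp , _)          = ¬comp comp
  stops⇒¬step (inj₂ (inj₁ ef))   (_ , ¬ef , _)        = ¬ef ef
  stops⇒¬step (inj₂ (inj₂ ¬des)) (_ , _ , c , des , _) = ¬des (c , des)

  eliminatedFile-star : ∀ {P R : Config n} → HasEliminatedFile P → Star Step P R → HasEliminatedFile R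
  eliminatedFile-star ef ε                   = ef
  eliminatedFile-star ef ((_ , ¬ef , _) ◅ _) = ⊥-elim (¬ef ef)

  desolateStep : ∀ {P : Config n} {c} → Desolate P c → ¬ HasEliminatedFile P →
                 Step P (autoElim (placeRook P c))
  desolateStep des ¬ef = desolate⇒¬completed des , ¬ef , _ , des , refl

  placeRook-here : ∀ (P : Config n) c → placeRook P c c ≡ rook
  placeRook-here P c with c ≟ᶜ c
  ... | yes _  = refl
  ... | no c≢c = ⊥-elim (c≢c refl)

  placeRook-elsewhere : ∀ (P : Config n) {c x} → x ≢ c → placeRook P c x ≡ P x
  placeRook-elsewhere P {c} {x} x≢c with x ≟ᶜ c
  ... | yes x≡c = ⊥-elim (x≢c x≡c)
  ... | no _    = refl

  placeRook-rook : ∀ (P : Config n) {c} y → placeRook P c y ≡ rook → y ≡ c ⊎ P y ≡ rook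
  placeRook-rook P {c} y r with y ≟ᶜ c
  ... | yes eq = inj₁ eq
  ... | no _   = inj₂ r

  someLineHasRook-true : ∀ (R : Config n) d x → LineHasRook R d x → someLineHasRook R x ≡ true
  someLineHasRook-true R d x (k , r) = on d (trans (isYes≗does (any? _)) (dec-true (any? _) (k , cong isRook r)))
    where
    on : ∀ d → lineHasRook R d x ≡ true → someLineHasRook R x ≡ true
    on d₁ eq rewrite eq = refl
    on d₂ eq rewrite eq = ∨-zeroʳ (lineHasRook R d₁ x)
    on d₃ eq rewrite eq | ∨-zeroʳ (lineHasRook R d₂ x) = ∨-zeroʳ (lineHasRook R d₁ x)

  someLineHasRook-false : ∀ (R : Config n) x → (∀ d → ¬ LineHasRook R d x) → someLineHasRook R x ≡ false
  someLineHasRook-false R x ¬line = cong₂ _∨_ (off d₁) (cong₂ _∨_ (off d₂) (off d₃))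
    where
    off : ∀ d → lineHasRook R d x ≡ false
    off d = trans (isYes≗does (any? _)) (dec-false (any? _) λ { (k , r) → ¬line d (k , isRook⇒≡rook _ r) })

  autoElim-onRookLine : ∀ (R : Config n) x → (R x ≡ dot → someLineHasRook R x ≡ true) →
                        autoElim R x ≡ eliminate (R x)
  autoElim-onRookLine R x = go (R x) (someLineHasRook R x)
    where
    go : ∀ s b → (s ≡ dot → b ≡ true) → (if isDot s ∧ b then empty else s) ≡ eliminate s
    go rook  b _ = refl
    go empty b _ = refl
    go dot   b h rewrite h refl = refl

  autoElim-offRookLine : ∀ (R : Config n) x → (R x ≡ dot → someLineHasRook R x ≡ false) →
                         autoElim R x ≡ R x
  autoElim-offRookLine R x = go (R x) (someLineHasRook R x)
    where
    go : ∀ s b → (s ≡ dot → b ≡ false) → (if isDot s ∧ b then empty else s) ≡ s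
    go rook  b _ = refl
    go empty b _ = refl
    go dot   b h rewrite h refl = refl

  extend : Config n → Cell n → Config n
  extend P c x = update (x ≟ᶜ c) (collinear? x c) (P x)

  extend-rook : ∀ (P : Config n) {c} y → extend P c y ≡ rook → y ≡ c ⊎ P y ≡ rook
  extend-rook P {c} y = update-rook (y ≟ᶜ c) (collinear? y c) (P y)

  extend-dot : ∀ (P : Config n) {c} y → extend P c y ≡ dot → y ≢ c × ¬ Collinear y c × P y ≡ dot
  extend-dot P {c} y = update-dot (y ≟ᶜ c) (collinear? y c) (P y)

  extend-cong : ∀ {P P′ : Config n} {c} → P ≐ P′ → extend P c ≐ extend P′ c
  extend-cong {c = c} eq x = cong (update (x ≟ᶜ c) (collinear? x c)) (eq x)

  autoElim-placeRook : ∀ {P : Config n} {c} → AutoEliminated P → autoElim (placeRook P c) ≐ extend P c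
  autoElim-placeRook {P} {c} ae x = cases x (x ≟ᶜ c) (collinear? x c)
    where
    R = placeRook P c
    rook≢dot : rook ≢ dot
    rook≢dot ()
    noRook : ∀ {x} → ¬ Collinear x c → P x ≡ dot → ∀ d → ¬ LineHasRook R d x
    noRook {x} ¬col dx d (k , r) with placeRook-rook P (set d k x) r
    ... | inj₁ eq = ¬col (set⇒collinear d k x c eq)
    ... | inj₂ r′ = ae x dx d (k , r′)
    cases : ∀ x → Dec (x ≡ c) → Dec (Collinear x c) → autoElim R x ≡ extend P c x
    cases x (yes refl) _ = begin
      autoElim R c       ≡⟨ autoElim-onRookLine R c (λ dc → ⊥-elim (rook≢dot (trans (sym (placeRook-here P c)) dc))) ⟩
      eliminate (R c)    ≡⟨ cong eliminate (placeRook-here P c) ⟩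
      rook               ≡⟨ sym (update-yes (c ≟ᶜ c) (collinear? c c) (P c) refl) ⟩
      extend P c c       ∎
    cases x (no x≢c) (yes col@(d , eq)) = begin
      autoElim R x       ≡⟨ autoElim-onRookLine R x (λ _ → someLineHasRook-true R d x
                              (get d c , trans (cong R eq) (placeRook-here P c))) ⟩
      eliminate (R x)    ≡⟨ cong eliminate (placeRook-elsewhere P x≢c) ⟩
      eliminate (P x)    ≡⟨ sym (update-no-yes (x ≟ᶜ c) (collinear? x c) (P x) x≢c col) ⟩
      extend P c x       ∎
    cases x (no x≢c) (no ¬col) = begin
      autoElim R x       ≡⟨ autoElim-offRookLine R x (λ dx → someLineHasRook-false R x
                              (noRook ¬col (trans (sym (placeRook-elsewhere P x≢c)) dx))) ⟩
      R x                ≡⟨ placeRook-elsewhere P x≢c ⟩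
      P x                ≡⟨ sym (update-no-no (x ≟ᶜ c) (collinear? x c) (P x) x≢c ¬col) ⟩
      extend P c x       ∎

  extend-autoEliminated : ∀ {P : Config n} {c} → AutoEliminated P → AutoEliminated (extend P c)
  extend-autoEliminated {P} {c} ae x dx d (k , r)
    with extend-dot P x dx
  ... | _ , ¬col , dx′ with extend-rook P (set d k x) r
  ...   | inj₁ eq = ¬col (set⇒collinear d k x c eq)
  ...   | inj₂ r′ = ae x dx′ d (k , r′)

  autoEliminated-step : ∀ {P Q : Config n} → AutoEliminated P → Step P Q → AutoEliminated Q
  autoEliminated-step ae (_ , _ , _ , _ , refl) =
    autoEliminated-resp (≐-sym (autoElim-placeRook ae)) (extend-autoEliminated ae)

  extend-eliminatedFile : ∀ {P : Config n} {c} → P c ≡ dot → HasEliminatedFile P → HasEliminatedFile (extend P c)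
  extend-eliminatedFile {P} {c} dc (d , x , f) = d , x , λ k →
    (λ r → noRook k (extend-rook P (set d k x) r)) ,
    (λ dy → proj₂ (f k) (proj₂ (proj₂ (extend-dot P (set d k x) dy))))
    where
    noRook : ∀ k → ¬ (set d k x ≡ c ⊎ P (set d k x) ≡ rook)
    noRook k (inj₁ eq) = proj₂ (f k) (trans (cong P eq) dc)
    noRook k (inj₂ r)  = proj₁ (f k) r

  -- The desolate line of c′ loses its only dot, c′ itself, which lies on a line through c.
  extend-collinear-eliminatedFile : ∀ {P : Config n} {c c′} → P c ≡ dot → Desolate P c′ → c ≢ c′ →
                                    Collinear c′ c → HasEliminatedFile (extend P c)
  extend-collinear-eliminatedFile {P} {c} {c′} dc (_ , d , noRook , onlyDot) c≢c′ col = d , c′ , λ k →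
    (λ r → noRook′ k (extend-rook P (set d k c′) r)) ,
    (λ dy → noDot k (extend-dot P (set d k c′) dy))
    where
    noRook′ : ∀ k → ¬ (set d k c′ ≡ c ⊎ P (set d k c′) ≡ rook)
    noRook′ k (inj₁ eq) = c≢c′ (trans (sym eq) (onlyDot k (trans (cong P eq) dc)))
    noRook′ k (inj₂ r)  = noRook k r
    noDot : ∀ k → ¬ (set d k c′ ≢ c × ¬ Collinear (set d k c′) c × P (set d k c′) ≡ dot)
    noDot k (_ , ¬col , dy) = ¬col (subst (λ y → Collinear y c) (sym (onlyDot k dy)) col)

  extend-desolate : ∀ {P : Config n} {c c′} → ¬ Collinear c′ c → Desolate P c′ → Desolate (extend P c) c′
  extend-desolate {P} {c} {c′} ¬col (dc′ , d , noRook , onlyDot) =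
    trans (update-no-no (c′ ≟ᶜ c) (collinear? c′ c) (P c′) c′≢c ¬col) dc′ , d ,
    (λ k r → noRook′ k (extend-rook P (set d k c′) r)) ,
    (λ k dy → onlyDot k (proj₂ (proj₂ (extend-dot P (set d k c′) dy))))
    where
    c′≢c : c′ ≢ c
    c′≢c refl = ¬col (collinear-refl c′)
    noRook′ : ∀ k → ¬ (set d k c′ ≡ c ⊎ P (set d k c′) ≡ rook)
    noRook′ k (inj₁ eq) = ¬col (set⇒collinear d k c′ c eq)
    noRook′ k (inj₂ r)  = noRook k r

  extend-comm : ∀ {P : Config n} {c c′} → ¬ Collinear c c′ → extend (extend P c) c′ ≐ extend (extend P c′) c
  extend-comm {P} {c} {c′} ¬col x =
    update-comm (x ≟ᶜ c) (collinear? x c) (x ≟ᶜ c′) (collinear? x c′) (P x)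
      (λ { refl → (λ { refl → ¬col (collinear-refl c) }) , ¬col })
      (λ { refl → (λ { refl → ¬col (collinear-refl c) }) , ¬col ∘ collinear-sym })

  run-resp : ∀ {P P′ R : Config n} → AutoEliminated P → P ≐ P′ → Run P R → ∃[ R′ ] Run P′ R′ × R ≐ R′
  run-resp ae eq (ε , st) = _ , (ε , stops-resp eq st) , eq
  run-resp {P′ = P′} ae eq (s@(_ , ¬ef , c , des , refl) ◅ A , st) =
    let R′ , (A′ , st′) , R≐R′ = run-resp (autoEliminated-step ae s) next≐ (A , st)
    in R′ , (desolateStep (desolate-resp eq des) (¬ef ∘ eliminatedFile-resp (≐-sym eq)) ◅ A′ , st′) , R≐R′
    where
    next≐ : autoElim (placeRook _ c) ≐ autoElim (placeRook P′ c)
    next≐ = ≐-trans (autoElim-placeRook ae)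
              (≐-trans (extend-cong eq) (≐-sym (autoElim-placeRook (autoEliminated-resp eq ae))))

  _≈_ : Config n → Config n → Set
  R ≈ R′ = (HasEliminatedFile R × HasEliminatedFile R′) ⊎ R ≐ R′

  ≈-refl : ∀ {R : Config n} → R ≈ R
  ≈-refl = inj₂ ≐-refl

  ≈-sym : ∀ {R R′ : Config n} → R ≈ R′ → R′ ≈ R
  ≈-sym (inj₁ (ef , ef′)) = inj₁ (ef′ , ef)
  ≈-sym (inj₂ eq)         = inj₂ (≐-sym eq)

  ≈-trans : ∀ {R R′ R″ : Config n} → R ≈ R′ → R′ ≈ R″ → R ≈ R″
  ≈-trans (inj₁ (ef , _))   (inj₁ (_ , ef″))  = inj₁ (ef , ef″)
  ≈-trans (inj₁ (ef , ef′)) (inj₂ eq)         = inj₁ (ef , eliminatedFile-resp eq ef′)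
  ≈-trans (inj₂ eq)         (inj₁ (ef′ , ef″)) = inj₁ (eliminatedFile-resp (≐-sym eq) ef′ , ef″)
  ≈-trans (inj₂ eq)         (inj₂ eq′)        = inj₂ (≐-trans eq eq′)

  extend-run⇒run : ∀ {P Y R : Config n} {c} → AutoEliminated P → Desolate P c → Y ≐ extend P c →
                   Run Y R → ∃[ R′ ] Run P R′ × R ≈ R′
  extend-run⇒run {P} {R = R} ae des Y≐ (A , st) = go (eliminatedFile? P)
    where
    go : Dec (HasEliminatedFile P) → ∃[ R′ ] Run P R′ × R ≈ R′
    go (yes ef) =
      let efY = eliminatedFile-resp (≐-sym Y≐) (extend-eliminatedFile (proj₁ des) ef)
      in P , (ε , inj₂ (inj₁ ef)) , inj₁ (eliminatedFile-star efY A , ef)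
    go (no ¬ef) =
      let aeY = autoEliminated-resp (≐-sym Y≐) (extend-autoEliminated ae)
          R′ , (A′ , st′) , R≐R′ = run-resp aeY (≐-trans Y≐ (≐-sym (autoElim-placeRook ae))) (A , st)
      in R′ , (desolateStep des ¬ef ◅ A′ , st′) , inj₂ R≐R′

  Divertible : Config n → Config n → Set
  Divertible P R = ∀ {Q} → Step P Q → ∃[ R′ ] Run Q R′ × R ≈ R′

  diamond : ∀ {P R : Config n} {c c′} → AutoEliminated P → Desolate P c → Desolate P c′ → ¬ Collinear c′ c →
            Star Step (autoElim (placeRook P c′)) R → Divertible (autoElim (placeRook P c′)) R →
            ∃[ R′ ] Run (autoElim (placeRook P c)) R′ × R ≈ R′
  diamond {P} {R} {c} {c′} ae des des′ ¬col A divert = go (eliminatedFile? Q′)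
    where
    Q Q′ : Config n
    Q  = autoElim (placeRook P c)
    Q′ = autoElim (placeRook P c′)
    aeQ : AutoEliminated Q
    aeQ = autoEliminated-resp (≐-sym (autoElim-placeRook ae)) (extend-autoEliminated ae)
    desQc′ : Desolate Q c′
    desQc′ = desolate-resp (≐-sym (autoElim-placeRook ae)) (extend-desolate {P = P} ¬col des′)
    desQ′c : Desolate Q′ c
    desQ′c = desolate-resp (≐-sym (autoElim-placeRook ae)) (extend-desolate {P = P} (¬col ∘ collinear-sym) des)
    square : extend Q′ c ≐ extend Q c′
    square = ≐-trans (extend-cong (autoElim-placeRook ae))
               (≐-trans (extend-comm ¬col) (extend-cong (≐-sym (autoElim-placeRook ae))))
    go : Dec (HasEliminatedFile Q′) → ∃[ R′ ] Run Q R′ × R ≈ R′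
    go (yes ef′) =
      let efY = eliminatedFile-resp square (extend-eliminatedFile (proj₁ desQ′c) ef′)
          R′ , run′ , Y≈R′ = extend-run⇒run aeQ desQc′ ≐-refl (ε , inj₂ (inj₁ efY))
      in R′ , run′ , ≈-trans (inj₁ (eliminatedFile-star ef′ A , efY)) Y≈R′
    go (no ¬ef′) =
      let aeQ′ = autoEliminated-resp (≐-sym (autoElim-placeRook ae)) (extend-autoEliminated ae)
          R″ , run″ , R≈R″ = divert (desolateStep desQ′c ¬ef′)
          R′ , run′ , R″≈R′ = extend-run⇒run aeQ desQc′ (≐-trans (autoElim-placeRook aeQ′) square) run″
      in R′ , run′ , ≈-trans R≈R″ R″≈R′

  step-collinear-eliminatedFile : ∀ {P : Config n} {c c′} → AutoEliminated P → P c ≡ dot → Desolate P c′ →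
                                  c ≢ c′ → Collinear c′ c → HasEliminatedFile (autoElim (placeRook P c))
  step-collinear-eliminatedFile ae dc des′ c≢c′ col =
    eliminatedFile-resp (≐-sym (autoElim-placeRook ae)) (extend-collinear-eliminatedFile dc des′ c≢c′ col)

  run-diverted : ∀ {P R : Config n} → AutoEliminated P → Star Step P R → Stops R → Divertible P R
  run-diverted ae ε st s = ⊥-elim (stops⇒¬step st s)
  run-diverted {R = R} ae (s′@(_ , _ , c′ , des′ , refl) ◅ A) st (_ , _ , c , des , refl)
    with c ≟ᶜ c′ | collinear? c′ c
  ... | yes refl | _ = R , (A , st) , ≈-refl
  ... | no c≢c′ | yes col =
    let ef = step-collinear-eliminatedFile ae (proj₁ des) des′ c≢c′ col
        ef′ = step-collinear-eliminatedFile ae (proj₁ des′) des (c≢c′ ∘ sym) (collinear-sym col)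
    in _ , (ε , inj₂ (inj₁ ef)) , inj₁ (eliminatedFile-star ef′ A , ef)
  ... | no _ | no ¬col = diamond ae des des′ ¬col A (run-diverted (autoEliminated-step ae s′) A st)

  runs-≈ : ∀ {P R₁ R₂ : Config n} → AutoEliminated P → Run P R₁ → Run P R₂ → R₁ ≈ R₂
  runs-≈ ae (ε , _)   (ε , _)      = ≈-refl
  runs-≈ ae (ε , st₁) (s ◅ _ , _)  = ⊥-elim (stops⇒¬step st₁ s)
  runs-≈ ae (s ◅ A₁ , st₁) (A₂ , st₂) =
    let R₂′ , run₂′ , R₂≈R₂′ = run-diverted ae A₂ st₂ s
    in ≈-trans (runs-≈ (autoEliminated-step ae s) (A₁ , st₁) run₂′) (≈-sym R₂≈R₂′)

mainTheorem5 : ∀ (n : ℕ) (P R₁ R₂ : Config n) →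
    IsPLSC P → AutoEliminated P → Run P R₁ → Run P R₂ →
    (HasEliminatedFile R₁ → HasEliminatedFile R₂) ×
    (Completed R₁ → Completed R₂ × R₁ ≐ R₂) ×
    (¬ HasEliminatedFile R₁ → ¬ Completed R₁ → R₁ ≐ R₂)
mainTheorem5 n P R₁ R₂ _ ae run₁ run₂ with runs-≈ ae run₁ run₂
... | inj₁ (ef₁ , ef₂) =
  (λ _ → ef₂) , (λ comp → ⊥-elim (completed⇒¬eliminatedFile {P = R₁} comp ef₁)) , (λ ¬ef₁ _ → ⊥-elim (¬ef₁ ef₁))
... | inj₂ R₁≐R₂ =
  eliminatedFile-resp {P = R₁} R₁≐R₂ , (λ comp → completed-resp {P = R₁} R₁≐R₂ comp , R₁≐R₂) , (λ _ _ → R₁≐R₂)
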